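{- Let $U(n)$ be defined by $\sum_{n=0}^{\infty} U(n)q^n = (-q;q)_{\infty}\sum_{n=0}^{\infty}\frac{(-1)^n q^{\binom{n+1}{2}}}{(-q;q)_n}$. Then $$\sum_{n=0}^{\infty} U(n) q^n=\sum_{n=0}^{\infty} a_d(n)q^n=(-q;q)_{\infty}\sum_{n=0}^{\infty}\frac{(-1)^n q^{\binom{n+1}{2}}}{(-q;q)_n},$$ i.e. $U(n)=a_d(n)$ for all $n\ge 0$.
   Context: For a partition $\pi$, $\mathrm{mex}(\pi)$ is the least positive integer that is not a part of $\pi$ (the empty partition has $\mathrm{mex}=1$). Let $\mathcal{D}(n)$ be the set of partitions of $n$ into distinct parts, and $a_d(n)$ the number of $\pi\in\mathcal{D}(n)$ with $\mathrm{mex}(\pi)$ odd. Notation: $(a;q)_0=1$, $(a;q)_n=\prod_{j=0}^{n-1}(1-aq^j)$, $(a;q)_\infty=\prod_{j\ge0}(1-aq^j)$. -}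

module Defs where

open import Data.Bool using (Bool; true; false; if_then_else_)
open import Data.Nat as ℕ using (ℕ; zero; suc; _∸_; _≡ᵇ_; _%_; _/_)
open import Data.Nat.Properties using (_≟_)
open import Data.Integer as ℤ using (ℤ; +_; 0ℤ; 1ℤ; -1ℤ)
open import Data.List using (List; []; _∷_; map; filter; length; upTo; foldr; _++_)
open import Data.List.Membership.DecPropositional _≟_ using (_∈?_)
open import Relation.Nullary.Decidable using (does)

PS : Set
PS = ℕ → ℤ

sumℤ : List ℤ → ℤ
sumℤ = foldr ℤ._+_ 0ℤ

sumTo : (ℕ → ℤ) → ℕ → ℤ
sumTo f n = sumℤ (map f (upTo (suc n)))

_⋆_ : PS → PS → PS
(f ⋆ g) n = sumTo (λ i → f i ℤ.* g (n ∸ i)) n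

infixl 7 _⋆_

one : PS
one N = if N ≡ᵇ 0 then 1ℤ else 0ℤ

qpow : ℕ → PS
qpow k N = if N ≡ᵇ k then 1ℤ else 0ℤ

onePlusQ^ : ℕ → PS
onePlusQ^ k N = one N ℤ.+ qpow k N

poch : ℕ → PS
poch zero = one
poch (suc n) = poch n ⋆ onePlusQ^ (suc n)

-- 1/(1+q^k) for k = suc j ≥ 1, i.e. Σ_{m≥0} (-1)^m q^{k m}
invOnePlusQ^ : ℕ → PS
invOnePlusQ^ j N =
  if (N % suc j) ≡ᵇ 0 then -1ℤ ℤ.^ (N / suc j) else 0ℤ

invPoch : ℕ → PS
invPoch zero = one
invPoch (suc n) = invPoch n ⋆ invOnePlusQ^ n

-- binomial (n+1 choose 2) = 1 + 2 + ... + n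
tri : ℕ → ℕ
tri zero = zero
tri (suc n) = suc n ℕ.+ tri n

term : ℕ → PS
term n N = (-1ℤ ℤ.^ n) ℤ.* (qpow (tri n) ⋆ invPoch n) N

-- Σ_{n≥0} term n : the n-th summand has order tri n ≥ n, so only
-- n ≤ N contribute to the coefficient of q^N.
seriesSum : PS
seriesSum N = sumTo (λ n → term n N) N

-- (-q;q)_∞ : the factors (1+q^j) with j > N do not affect the
-- coefficient of q^N, so it equals that of (-q;q)_N.
pochInf : PS
pochInf N = poch N N

U : ℕ → ℤ
U = pochInf ⋆ seriesSum

-- dpartsBounded m n : all lists of strictly decreasing positive parts,
-- each ≤ m, summing to n (each such partition listed exactly once).
dpartsBounded : ℕ → ℕ → List (List ℕ)
dpartsBounded m zero = [] ∷ []
dpartsBounded zero (suc n) = []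
dpartsBounded (suc m) (suc n) =
  (if suc m ℕ.≤ᵇ suc n
     then map (suc m ∷_) (dpartsBounded m (suc n ∸ suc m))
     else [])
  ++ dpartsBounded m (suc n)

dparts : ℕ → List (List ℕ)
dparts n = dpartsBounded n n

mexFrom : ℕ → ℕ → List ℕ → ℕ
mexFrom zero k π = k
mexFrom (suc f) k π = if does (k ∈? π) then mexFrom f (suc k) π else k

-- mex(π): least positive integer not a part of π.  The fuel
-- length π + 1 suffices since mex(π) ≤ length π + 1.
mex : List ℕ → ℕ
mex π = mexFrom (suc (length π)) 1 π

isOdd : ℕ → Bool
isOdd n = (n % 2) ≡ᵇ 1

a-d : ℕ → ℕ
a-d n = length (filter (λ π → Relation.Nullary.Decidable.T? (isOdd (mex π))) (dparts n))

{-# OPTIONS --safe #-}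
module Submission where

open import Defs
open import Data.Nat using (ℕ)
open import Data.Integer using (ℤ; +_)
open import Relation.Binary.PropositionalEquality using (_≡_)

open import Data.Bool using (Bool; true; false; if_then_else_)
open import Data.Nat using (zero; suc; _∸_; _≤_; _<_; z≤n; s≤s; _≤ᵇ_; _≤?_; _≟_)
import Data.Nat as ℕ
import Data.Nat.Properties as ℕₚ
open import Data.Integer using (0ℤ; 1ℤ; -1ℤ; _+_; _*_; _^_)
import Data.Integer.Properties as ℤₚ
open import Data.Integer.Tactic.RingSolver using (solve-∀)
open import Data.List using (List; []; _∷_; map; length; filter; _++_)
open import Data.List.Properties using (map-upTo; map-applyUpTo)
open import Data.List.Membership.DecPropositional _≟_ using (_∈_; _∉_; _∈?_)
open import Data.List.Relation.Unary.Any using (here; there)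
open import Data.List.Relation.Unary.All as All using (All; []; _∷_)
open import Data.List.Relation.Unary.All.Properties using (++⁺; map⁺)
open import Data.Nat.DivMod using (_%_; _/_; [m+n]%n≡m%n; m<n⇒m%n≡m; m<n⇒m/n≡0; m/n≡1+[m∸n]/n)
open import Data.Product using (∃; _,_)
open import Data.Sum using (inj₁; inj₂)
open import Data.Empty using (⊥-elim)
open import Function using (_∘_; const)
open import Relation.Nullary using (Dec; yes; no)
open import Relation.Nullary.Decidable using (does; T?; dec-true; dec-false)
open import Relation.Binary.PropositionalEquality
  using (refl; sym; trans; cong; cong₂; subst; _≗_; _→-setoid_; module ≡-Reasoning)
import Relation.Binary.Reasoning.Setoid as SetoidReasoning

-- Put Eₘ = (-q;q)ₘ Σ_{n≤m} (-1)ⁿ q^(n+1 choose 2) / (-q;q)ₙ  (partialU m), so that U(N) = [q^N] E_N.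
-- As (-q;q)_{m+1} cancels the denominator of the new summand,
--   E_{m+1} = (1 + q^{m+1}) Eₘ + (-1)^{m+1} q^(m+2 choose 2) = Eₘ + q^{m+1} (Eₘ + (-1)^{m+1} q^(m+1 choose 2)).
-- Let Cₘ (distinctPartsGF mexOdd m) count the distinct-part partitions with parts ≤ m and odd mex,
-- so that a_d(N) = [q^N] C_N.  Adjoining the new largest part m+1 to such a π keeps its mex,
-- unless π = {1,…,m} (weight q^(m+1 choose 2)), when the mex moves from m+1 to m+2 and its parity
-- flips by (-1)^{m+1}.  Hence Cₘ obeys the same recurrence as Eₘ, and C₀ = E₀ = 1.

-1^_ : ℕ → ℤ
-1^ n = -1ℤ ^ n

sumTo-zero : ∀ f → sumTo f 0 ≡ f 0
sumTo-zero f = ℤₚ.+-identityʳ (f 0)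

sumTo-suc : ∀ f n → sumTo f (suc n) ≡ f 0 + sumTo (f ∘ suc) n
sumTo-suc f n =
  cong (λ xs → f 0 + sumℤ xs) (trans (map-applyUpTo suc f (suc n)) (sym (map-upTo (f ∘ suc) (suc n))))

sumTo-sucʳ : ∀ f n → sumTo f (suc n) ≡ sumTo f n + f (suc n)
sumTo-sucʳ f zero = trans (sumTo-suc f 0) (cong₂ _+_ (sym (sumTo-zero f)) (sumTo-zero (f ∘ suc)))
sumTo-sucʳ f (suc n) = begin
  sumTo f (suc (suc n))                        ≡⟨ sumTo-suc f (suc n) ⟩
  f 0 + sumTo (f ∘ suc) (suc n)                ≡⟨ cong (_+_ (f 0)) (sumTo-sucʳ (f ∘ suc) n) ⟩
  f 0 + (sumTo (f ∘ suc) n + f (suc (suc n)))  ≡⟨ ℤₚ.+-assoc (f 0) _ _ ⟨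
  (f 0 + sumTo (f ∘ suc) n) + f (suc (suc n))  ≡⟨ cong (_+ f (suc (suc n))) (sumTo-suc f n) ⟨
  sumTo f (suc n) + f (suc (suc n))            ∎
  where open ≡-Reasoning

sumTo-cong : ∀ f g n → (∀ i → i ≤ n → f i ≡ g i) → sumTo f n ≡ sumTo g n
sumTo-cong f g zero f≡g = trans (sumTo-zero f) (trans (f≡g 0 z≤n) (sym (sumTo-zero g)))
sumTo-cong f g (suc n) f≡g = begin
  sumTo f (suc n)          ≡⟨ sumTo-suc f n ⟩
  f 0 + sumTo (f ∘ suc) n  ≡⟨ cong₂ _+_ (f≡g 0 z≤n) (sumTo-cong (f ∘ suc) (g ∘ suc) n λ i i≤n → f≡g (suc i) (s≤s i≤n)) ⟩
  g 0 + sumTo (g ∘ suc) n  ≡⟨ sumTo-suc g n ⟨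
  sumTo g (suc n)          ∎
  where open ≡-Reasoning

sumTo-distrib-+ : ∀ f g n → sumTo (λ i → f i + g i) n ≡ sumTo f n + sumTo g n
sumTo-distrib-+ f g zero = trans (sumTo-zero (λ i → f i + g i)) (sym (cong₂ _+_ (sumTo-zero f) (sumTo-zero g)))
sumTo-distrib-+ f g (suc n) = begin
  sumTo (λ i → f i + g i) (suc n)
    ≡⟨ sumTo-suc (λ i → f i + g i) n ⟩
  (f 0 + g 0) + sumTo (λ i → f (suc i) + g (suc i)) n
    ≡⟨ cong (_+_ (f 0 + g 0)) (sumTo-distrib-+ (f ∘ suc) (g ∘ suc) n) ⟩
  (f 0 + g 0) + (sumTo (f ∘ suc) n + sumTo (g ∘ suc) n)
    ≡⟨ interchange (f 0) (g 0) _ _ ⟩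
  (f 0 + sumTo (f ∘ suc) n) + (g 0 + sumTo (g ∘ suc) n)
    ≡⟨ cong₂ _+_ (sumTo-suc f n) (sumTo-suc g n) ⟨
  sumTo f (suc n) + sumTo g (suc n) ∎
  where
  open ≡-Reasoning
  interchange : ∀ a b c d → (a + b) + (c + d) ≡ (a + c) + (b + d)
  interchange = solve-∀

sumTo-*ˡ : ∀ c f n → sumTo (λ i → c * f i) n ≡ c * sumTo f n
sumTo-*ˡ c f zero = trans (sumTo-zero (λ i → c * f i)) (cong (c *_) (sym (sumTo-zero f)))
sumTo-*ˡ c f (suc n) = begin
  sumTo (λ i → c * f i) (suc n)           ≡⟨ sumTo-suc (λ i → c * f i) n ⟩
  c * f 0 + sumTo (λ i → c * f (suc i)) n  ≡⟨ cong (_+_ (c * f 0)) (sumTo-*ˡ c (f ∘ suc) n) ⟩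
  c * f 0 + c * sumTo (f ∘ suc) n         ≡⟨ ℤₚ.*-distribˡ-+ c (f 0) _ ⟨
  c * (f 0 + sumTo (f ∘ suc) n)           ≡⟨ cong (c *_) (sumTo-suc f n) ⟨
  c * sumTo f (suc n)                     ∎
  where open ≡-Reasoning

sumTo-vanish : ∀ f n → (∀ i → i ≤ n → f i ≡ 0ℤ) → sumTo f n ≡ 0ℤ
sumTo-vanish f zero f≡0 = trans (sumTo-zero f) (f≡0 0 z≤n)
sumTo-vanish f (suc n) f≡0 = trans (sumTo-suc f n)
  (cong₂ _+_ (f≡0 0 z≤n) (sumTo-vanish (f ∘ suc) n λ i i≤n → f≡0 (suc i) (s≤s i≤n)))

sumTo-reverse : ∀ f n → sumTo (λ i → f (n ∸ i)) n ≡ sumTo f n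
sumTo-reverse f zero = refl
sumTo-reverse f (suc n) = begin
  sumTo (λ i → f (suc n ∸ i)) (suc n)    ≡⟨ sumTo-suc (λ i → f (suc n ∸ i)) n ⟩
  f (suc n) + sumTo (λ i → f (n ∸ i)) n  ≡⟨ cong (_+_ (f (suc n))) (sumTo-reverse f n) ⟩
  f (suc n) + sumTo f n                  ≡⟨ ℤₚ.+-comm (f (suc n)) _ ⟩
  sumTo f n + f (suc n)                  ≡⟨ sumTo-sucʳ f n ⟨
  sumTo f (suc n)                        ∎
  where open ≡-Reasoning

sumTo-extend : ∀ f K M → K ≤ M → (∀ j → K < j → j ≤ M → f j ≡ 0ℤ) → sumTo f K ≡ sumTo f M
sumTo-extend f K zero z≤n _ = refl
sumTo-extend f K (suc M) K≤1+M f≡0 with ℕₚ.m≤n⇒m<n∨m≡n K≤1+M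
... | inj₂ refl = refl
... | inj₁ (s≤s K≤M) = begin
  sumTo f K              ≡⟨ sumTo-extend f K M K≤M (λ j K<j j≤M → f≡0 j K<j (ℕₚ.m≤n⇒m≤1+n j≤M)) ⟩
  sumTo f M              ≡⟨ ℤₚ.+-identityʳ _ ⟨
  sumTo f M + 0ℤ         ≡⟨ cong (_+_ (sumTo f M)) (f≡0 (suc M) (s≤s K≤M) ℕₚ.≤-refl) ⟨
  sumTo f M + f (suc M)  ≡⟨ sumTo-sucʳ f M ⟨
  sumTo f (suc M)        ∎
  where open ≡-Reasoning

module ≗-Reasoning = SetoidReasoning (ℕ →-setoid ℤ)

infixl 6 _⊕_
_⊕_ : PS → PS → PS
(f ⊕ g) N = f N + g N

infixr 7 _·_
_·_ : ℤ → PS → PS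
(c · f) N = c * f N

shift : ℕ → PS → PS
shift k f N = if k ≤ᵇ N then f (N ∸ k) else 0ℤ

⊕-cong : ∀ {f f′ g g′} → f ≗ f′ → g ≗ g′ → f ⊕ g ≗ f′ ⊕ g′
⊕-cong f≗f′ g≗g′ N = cong₂ _+_ (f≗f′ N) (g≗g′ N)

⊕-congˡ : ∀ f {g g′} → g ≗ g′ → f ⊕ g ≗ f ⊕ g′
⊕-congˡ f = ⊕-cong {f} (λ _ → refl)

·-congˡ : ∀ c {f g} → f ≗ g → c · f ≗ c · g
·-congˡ c f≗g N = cong (c *_) (f≗g N)

⋆-cong : ∀ {f f′ g g′} → f ≗ f′ → g ≗ g′ → f ⋆ g ≗ f′ ⋆ g′
⋆-cong {f} {f′} {g} {g′} f≗f′ g≗g′ N = sumTo-cong (λ i → f i * g (N ∸ i)) (λ i → f′ i * g′ (N ∸ i)) N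
  (λ i _ → cong₂ _*_ (f≗f′ i) (g≗g′ (N ∸ i)))

⋆-congˡ : ∀ f {g g′} → g ≗ g′ → f ⋆ g ≗ f ⋆ g′
⋆-congˡ f = ⋆-cong {f} (λ _ → refl)

⋆-congʳ : ∀ {f f′} g → f ≗ f′ → f ⋆ g ≗ f′ ⋆ g
⋆-congʳ g f≗f′ = ⋆-cong {g = g} f≗f′ (λ _ → refl)

⋆-comm : ∀ f g → f ⋆ g ≗ g ⋆ f
⋆-comm f g N = begin
  sumTo (λ i → f i * g (N ∸ i)) N                ≡⟨ sumTo-reverse (λ i → f i * g (N ∸ i)) N ⟨
  sumTo (λ i → f (N ∸ i) * g (N ∸ (N ∸ i))) N    ≡⟨ sumTo-cong _ (λ i → g i * f (N ∸ i)) N swap ⟩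
  sumTo (λ i → g i * f (N ∸ i)) N                ∎
  where
  open ≡-Reasoning
  swap : ∀ i → i ≤ N → f (N ∸ i) * g (N ∸ (N ∸ i)) ≡ g i * f (N ∸ i)
  swap i i≤N =
    trans (cong (λ j → f (N ∸ i) * g j) (ℕₚ.m∸[m∸n]≡n i≤N)) (ℤₚ.*-comm (f (N ∸ i)) (g i))

⋆-distribˡ : ∀ f g h → f ⋆ (g ⊕ h) ≗ f ⋆ g ⊕ f ⋆ h
⋆-distribˡ f g h N = trans
  (sumTo-cong _ (λ i → f i * g (N ∸ i) + f i * h (N ∸ i)) N (λ i _ → ℤₚ.*-distribˡ-+ (f i) _ _))
  (sumTo-distrib-+ (λ i → f i * g (N ∸ i)) (λ i → f i * h (N ∸ i)) N)

⋆-distribʳ : ∀ f g h → (f ⊕ g) ⋆ h ≗ f ⋆ h ⊕ g ⋆ h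
⋆-distribʳ f g h N =
  trans (⋆-comm (f ⊕ g) h N) (trans (⋆-distribˡ h f g N) (cong₂ _+_ (⋆-comm h f N) (⋆-comm h g N)))

⋆-·ʳ : ∀ c f g → f ⋆ (c · g) ≗ c · (f ⋆ g)
⋆-·ʳ c f g N = trans
  (sumTo-cong _ (λ i → c * (f i * g (N ∸ i))) N (λ i _ → exchange (f i) c (g (N ∸ i))))
  (sumTo-*ˡ c (λ i → f i * g (N ∸ i)) N)
  where
  exchange : ∀ a b d → a * (b * d) ≡ b * (a * d)
  exchange = solve-∀

⋆-·ˡ : ∀ c f g → (c · f) ⋆ g ≗ c · (f ⋆ g)
⋆-·ˡ c f g N = trans (⋆-comm (c · f) g N) (trans (⋆-·ʳ c g f N) (cong (c *_) (⋆-comm g f N)))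

⋆-suc : ∀ f g → (f ⋆ g) ∘ suc ≗ f 0 · (g ∘ suc) ⊕ (f ∘ suc) ⋆ g
⋆-suc f g N = sumTo-suc (λ i → f i * g (suc N ∸ i)) N

⋆-zero : ∀ f g → (f ⋆ g) 0 ≡ f 0 * g 0
⋆-zero f g = sumTo-zero (λ i → f i * g (0 ∸ i))

⋆-assoc : ∀ f g h → (f ⋆ g) ⋆ h ≗ f ⋆ (g ⋆ h)
⋆-assoc f g h zero = begin
  ((f ⋆ g) ⋆ h) 0      ≡⟨ ⋆-zero (f ⋆ g) h ⟩
  (f ⋆ g) 0 * h 0      ≡⟨ cong (_* h 0) (⋆-zero f g) ⟩
  f 0 * g 0 * h 0      ≡⟨ ℤₚ.*-assoc (f 0) (g 0) (h 0) ⟩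
  f 0 * (g 0 * h 0)    ≡⟨ cong (f 0 *_) (⋆-zero g h) ⟨
  f 0 * (g ⋆ h) 0      ≡⟨ ⋆-zero f (g ⋆ h) ⟨
  (f ⋆ (g ⋆ h)) 0      ∎
  where open ≡-Reasoning
⋆-assoc f g h (suc N) = begin
  ((f ⋆ g) ⋆ h) (suc N)
    ≡⟨ ⋆-suc (f ⋆ g) h N ⟩
  (f ⋆ g) 0 * h (suc N) + ((f ⋆ g) ∘ suc ⋆ h) N
    ≡⟨ cong₂ _+_ (cong (_* h (suc N)) (⋆-zero f g)) (⋆-congʳ h (⋆-suc f g) N) ⟩
  f 0 * g 0 * h (suc N) + ((f 0 · (g ∘ suc) ⊕ (f ∘ suc) ⋆ g) ⋆ h) N
    ≡⟨ cong (_+_ (f 0 * g 0 * h (suc N))) (⋆-distribʳ (f 0 · (g ∘ suc)) ((f ∘ suc) ⋆ g) h N) ⟩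
  f 0 * g 0 * h (suc N) + (((f 0 · (g ∘ suc)) ⋆ h) N + (((f ∘ suc) ⋆ g) ⋆ h) N)
    ≡⟨ cong (_+_ (f 0 * g 0 * h (suc N)))
            (cong₂ _+_ (⋆-·ˡ (f 0) (g ∘ suc) h N) (⋆-assoc (f ∘ suc) g h N)) ⟩
  f 0 * g 0 * h (suc N) + (f 0 * ((g ∘ suc) ⋆ h) N + ((f ∘ suc) ⋆ (g ⋆ h)) N)
    ≡⟨ factor (f 0) (g 0) (h (suc N)) (((g ∘ suc) ⋆ h) N) (((f ∘ suc) ⋆ (g ⋆ h)) N) ⟩
  f 0 * (g 0 * h (suc N) + ((g ∘ suc) ⋆ h) N) + ((f ∘ suc) ⋆ (g ⋆ h)) N
    ≡⟨ cong (λ x → f 0 * x + ((f ∘ suc) ⋆ (g ⋆ h)) N) (⋆-suc g h N) ⟨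
  f 0 * (g ⋆ h) (suc N) + ((f ∘ suc) ⋆ (g ⋆ h)) N
    ≡⟨ ⋆-suc f (g ⋆ h) N ⟨
  (f ⋆ (g ⋆ h)) (suc N) ∎
  where
  open ≡-Reasoning
  factor : ∀ a b c d e → a * b * c + (a * d + e) ≡ a * (b * c + d) + e
  factor = solve-∀

⋆-identityˡ : ∀ f → one ⋆ f ≗ f
⋆-identityˡ f zero = trans (⋆-zero one f) (ℤₚ.*-identityˡ (f 0))
⋆-identityˡ f (suc N) = begin
  (one ⋆ f) (suc N)
    ≡⟨ ⋆-suc one f N ⟩
  1ℤ * f (suc N) + ((one ∘ suc) ⋆ f) N
    ≡⟨ cong₂ _+_ (ℤₚ.*-identityˡ (f (suc N))) (sumTo-vanish _ N λ i _ → ℤₚ.*-zeroˡ (f (N ∸ i))) ⟩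
  f (suc N) + 0ℤ
    ≡⟨ ℤₚ.+-identityʳ (f (suc N)) ⟩
  f (suc N) ∎
  where open ≡-Reasoning

⋆-identityʳ : ∀ f → f ⋆ one ≗ f
⋆-identityʳ f N = trans (⋆-comm f one N) (⋆-identityˡ f N)

⋆-swapˡ : ∀ f g h → f ⋆ (g ⋆ h) ≗ g ⋆ (f ⋆ h)
⋆-swapˡ f g h = begin
  f ⋆ (g ⋆ h)   ≈⟨ ⋆-assoc f g h ⟨
  (f ⋆ g) ⋆ h   ≈⟨ ⋆-congʳ h (⋆-comm f g) ⟩
  (g ⋆ f) ⋆ h   ≈⟨ ⋆-assoc g f h ⟩
  g ⋆ (f ⋆ h)   ∎
  where open ≗-Reasoning

⋆-interchange : ∀ f g h k → (f ⋆ g) ⋆ (h ⋆ k) ≗ (f ⋆ h) ⋆ (g ⋆ k)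
⋆-interchange f g h k = begin
  (f ⋆ g) ⋆ (h ⋆ k)   ≈⟨ ⋆-assoc f g (h ⋆ k) ⟩
  f ⋆ (g ⋆ (h ⋆ k))   ≈⟨ ⋆-congˡ f (⋆-swapˡ g h k) ⟩
  f ⋆ (h ⋆ (g ⋆ k))   ≈⟨ ⋆-assoc f h (g ⋆ k) ⟨
  (f ⋆ h) ⋆ (g ⋆ k)   ∎
  where open ≗-Reasoning

shift-suc : ∀ k f N → shift (suc k) f (suc N) ≡ shift k f N
shift-suc zero    f N = refl
shift-suc (suc k) f N = refl

shift-below : ∀ k f {N} → N < k → shift k f N ≡ 0ℤ
shift-below k f {N} N<k rewrite dec-false (k ≤? N) (ℕₚ.<⇒≱ N<k) = refl

shift-cong : ∀ k {f g} → f ≗ g → shift k f ≗ shift k g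
shift-cong k f≗g N = cong (λ x → if k ≤ᵇ N then x else 0ℤ) (f≗g (N ∸ k))

shift-⊕ : ∀ k f g → shift k (f ⊕ g) ≗ shift k f ⊕ shift k g
shift-⊕ k f g N with k ≤ᵇ N
... | true  = refl
... | false = refl

shift-· : ∀ k c f → shift k (c · f) ≗ c · shift k f
shift-· k c f N with k ≤ᵇ N
... | true  = refl
... | false = sym (ℤₚ.*-zeroʳ c)

qpow-⋆ : ∀ k f → qpow k ⋆ f ≗ shift k f
qpow-⋆ zero    f = ⋆-identityˡ f
qpow-⋆ (suc k) f zero = trans (⋆-zero (qpow (suc k)) f) (ℤₚ.*-zeroˡ (f 0))
qpow-⋆ (suc k) f (suc N) = begin
  (qpow (suc k) ⋆ f) (suc N)             ≡⟨ ⋆-suc (qpow (suc k)) f N ⟩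
  0ℤ * f (suc N) + (qpow k ⋆ f) N        ≡⟨ ℤₚ.+-identityˡ _ ⟩
  (qpow k ⋆ f) N                         ≡⟨ qpow-⋆ k f N ⟩
  shift k f N                            ≡⟨ shift-suc k f N ⟨
  shift (suc k) f (suc N)                ∎
  where open ≡-Reasoning

qpow-+ : ∀ a b → qpow (a ℕ.+ b) ≗ shift a (qpow b)
qpow-+ zero    b N       = refl
qpow-+ (suc a) b zero    = refl
qpow-+ (suc a) b (suc N) = trans (qpow-+ a b N) (sym (shift-suc a (qpow b) N))

onePlusQ^-⋆ : ∀ k f → onePlusQ^ k ⋆ f ≗ f ⊕ shift k f
onePlusQ^-⋆ k f = begin
  (one ⊕ qpow k) ⋆ f          ≈⟨ ⋆-distribʳ one (qpow k) f ⟩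
  one ⋆ f ⊕ qpow k ⋆ f        ≈⟨ ⊕-cong (⋆-identityˡ f) (qpow-⋆ k f) ⟩
  f ⊕ shift k f               ∎
  where open ≗-Reasoning

invOnePlusQ^-below : ∀ j N → N < suc j → invOnePlusQ^ j N ≡ one N
invOnePlusQ^-below j N N<1+j rewrite m<n⇒m%n≡m N<1+j | m<n⇒m/n≡0 N<1+j with N
... | zero  = refl
... | suc _ = refl

invOnePlusQ^-step : ∀ j N → suc j ≤ N → invOnePlusQ^ j N + invOnePlusQ^ j (N ∸ suc j) ≡ 0ℤ
invOnePlusQ^-step j N k≤N = step
  where
  k = suc j
  %-step : N % k ≡ (N ∸ k) % k
  %-step = trans (cong (_% k) (sym (ℕₚ.m∸n+n≡m k≤N))) ([m+n]%n≡m%n (N ∸ k) k)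
  cancel : ∀ a → -1ℤ * a + a ≡ 0ℤ
  cancel = solve-∀
  step : invOnePlusQ^ j N + invOnePlusQ^ j (N ∸ k) ≡ 0ℤ
  step rewrite %-step | m/n≡1+[m∸n]/n {N} {k} k≤N with (N ∸ k) % k ℕ.≡ᵇ 0
  ... | true  = cancel (-1^ ((N ∸ k) / k))
  ... | false = refl

onePlusQ^-inverse : ∀ j → onePlusQ^ (suc j) ⋆ invOnePlusQ^ j ≗ one
onePlusQ^-inverse j N = trans (onePlusQ^-⋆ (suc j) (invOnePlusQ^ j) N) (coefficient (suc j ≤? N))
  where
  coefficient : Dec (suc j ≤ N) → invOnePlusQ^ j N + shift (suc j) (invOnePlusQ^ j) N ≡ one N
  coefficient (yes k≤N@(s≤s _)) rewrite dec-true (suc j ≤? N) k≤N = invOnePlusQ^-step j N k≤N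
  coefficient (no k≰N) rewrite dec-false (suc j ≤? N) k≰N =
    trans (ℤₚ.+-identityʳ _) (invOnePlusQ^-below j N (ℕₚ.≰⇒> k≰N))

poch-inverse : ∀ n → poch n ⋆ invPoch n ≗ one
poch-inverse zero = ⋆-identityˡ one
poch-inverse (suc n) = begin
  (poch n ⋆ onePlusQ^ (suc n)) ⋆ (invPoch n ⋆ invOnePlusQ^ n)
    ≈⟨ ⋆-interchange (poch n) (onePlusQ^ (suc n)) (invPoch n) (invOnePlusQ^ n) ⟩
  (poch n ⋆ invPoch n) ⋆ (onePlusQ^ (suc n) ⋆ invOnePlusQ^ n)
    ≈⟨ ⋆-cong (poch-inverse n) (onePlusQ^-inverse n) ⟩
  one ⋆ one
    ≈⟨ ⋆-identityˡ one ⟩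
  one ∎
  where open ≗-Reasoning

poch-⋆-term : ∀ n → poch n ⋆ term n ≗ -1^ n · qpow (tri n)
poch-⋆-term n = begin
  poch n ⋆ (s · (Q ⋆ invPoch n))   ≈⟨ ⋆-·ʳ s (poch n) (Q ⋆ invPoch n) ⟩
  s · (poch n ⋆ (Q ⋆ invPoch n))   ≈⟨ ·-congˡ s (⋆-swapˡ (poch n) Q (invPoch n)) ⟩
  s · (Q ⋆ (poch n ⋆ invPoch n))   ≈⟨ ·-congˡ s (⋆-congˡ Q (poch-inverse n)) ⟩
  s · (Q ⋆ one)                    ≈⟨ ·-congˡ s (⋆-identityʳ Q) ⟩
  s · Q                            ∎
  where
  open ≗-Reasoning
  s = -1^ n
  Q = qpow (tri n)

partialSum : ℕ → PS
partialSum m N = sumTo (λ n → term n N) m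

partialU : ℕ → PS
partialU m = poch m ⋆ partialSum m

partialU-zero : partialU 0 ≗ one
partialU-zero N = begin
  (one ⋆ partialSum 0) N   ≡⟨ ⋆-identityˡ (partialSum 0) N ⟩
  partialSum 0 N           ≡⟨ sumTo-zero (λ n → term n N) ⟩
  1ℤ * (one ⋆ one) N       ≡⟨ ℤₚ.*-identityˡ _ ⟩
  (one ⋆ one) N            ≡⟨ ⋆-identityˡ one N ⟩
  one N                    ∎
  where open ≡-Reasoning

partialU-suc : ∀ m →
  partialU (suc m) ≗ partialU m ⊕ shift (suc m) (partialU m ⊕ -1^ (suc m) · qpow (tri m))
partialU-suc m = begin
  poch (suc m) ⋆ partialSum (suc m)
    ≈⟨ ⋆-congˡ (poch (suc m)) (λ N → sumTo-sucʳ (λ n → term n N) m) ⟩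
  poch (suc m) ⋆ (partialSum m ⊕ term (suc m))
    ≈⟨ ⋆-distribˡ (poch (suc m)) (partialSum m) (term (suc m)) ⟩
  (poch m ⋆ A) ⋆ partialSum m ⊕ poch (suc m) ⋆ term (suc m)
    ≈⟨ ⊕-cong (⋆-congʳ (partialSum m) (⋆-comm (poch m) A)) (poch-⋆-term (suc m)) ⟩
  (A ⋆ poch m) ⋆ partialSum m ⊕ s · qpow (tri (suc m))
    ≈⟨ ⊕-cong (⋆-assoc A (poch m) (partialSum m)) (·-congˡ s (qpow-+ (suc m) (tri m))) ⟩
  A ⋆ partialU m ⊕ s · shift (suc m) (qpow (tri m))
    ≈⟨ ⊕-cong (onePlusQ^-⋆ (suc m) (partialU m)) (λ N → sym (shift-· (suc m) s (qpow (tri m)) N)) ⟩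
  partialU m ⊕ shift (suc m) (partialU m) ⊕ shift (suc m) (s · qpow (tri m))
    ≈⟨ (λ N → ℤₚ.+-assoc (partialU m N) _ _) ⟩
  partialU m ⊕ (shift (suc m) (partialU m) ⊕ shift (suc m) (s · qpow (tri m)))
    ≈⟨ ⊕-congˡ (partialU m) (shift-⊕ (suc m) (partialU m) (s · qpow (tri m))) ⟨
  partialU m ⊕ shift (suc m) (partialU m ⊕ s · qpow (tri m)) ∎
  where
  open ≗-Reasoning
  A = onePlusQ^ (suc m)
  s = -1^ (suc m)

poch-stable : ∀ M {i} → i ≤ M → poch (suc M) i ≡ poch M i
poch-stable M {i} i≤M = begin
  (poch M ⋆ onePlusQ^ (suc M)) i        ≡⟨ ⋆-comm (poch M) (onePlusQ^ (suc M)) i ⟩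
  (onePlusQ^ (suc M) ⋆ poch M) i        ≡⟨ onePlusQ^-⋆ (suc M) (poch M) i ⟩
  poch M i + shift (suc M) (poch M) i   ≡⟨ cong (_+_ (poch M i)) (shift-below (suc M) (poch M) (s≤s i≤M)) ⟩
  poch M i + 0ℤ                         ≡⟨ ℤₚ.+-identityʳ (poch M i) ⟩
  poch M i                              ∎
  where open ≡-Reasoning

pochInf≡poch : ∀ M {i} → i ≤ M → pochInf i ≡ poch M i
pochInf≡poch zero    z≤n = refl
pochInf≡poch (suc M) i≤1+M with ℕₚ.m≤n⇒m<n∨m≡n i≤1+M
... | inj₂ refl      = refl
... | inj₁ (s≤s i≤M) = trans (pochInf≡poch M i≤M) (sym (poch-stable M i≤M))

n≤tri[n] : ∀ n → n ≤ tri n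
n≤tri[n] zero    = z≤n
n≤tri[n] (suc n) = ℕₚ.m≤m+n (suc n) (tri n)

term-vanish : ∀ n {N} → N < n → term n N ≡ 0ℤ
term-vanish n {N} N<n = begin
  -1^ n * (qpow (tri n) ⋆ invPoch n) N
    ≡⟨ cong (-1^ n *_) (qpow-⋆ (tri n) (invPoch n) N) ⟩
  -1^ n * shift (tri n) (invPoch n) N
    ≡⟨ cong (-1^ n *_) (shift-below (tri n) (invPoch n) (ℕₚ.<-≤-trans N<n (n≤tri[n] n))) ⟩
  -1^ n * 0ℤ
    ≡⟨ ℤₚ.*-zeroʳ (-1^ n) ⟩
  0ℤ ∎
  where open ≡-Reasoning

seriesSum≡partialSum : ∀ M {N} → N ≤ M → seriesSum N ≡ partialSum M N
seriesSum≡partialSum M {N} N≤M = sumTo-extend (λ n → term n N) N M N≤M (λ n N<n _ → term-vanish n N<n)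

U≡partialU : ∀ N → U N ≡ partialU N N
U≡partialU N = sumTo-cong _ _ N λ i i≤N →
  cong₂ _*_ (pochInf≡poch N i≤N) (seriesSum≡partialSum N (ℕₚ.m∸n≤m N i))

mexFrom≡ : ∀ fuel k r π → k ≤ r → r < k ℕ.+ fuel →
           (∀ j → k ≤ j → j < r → j ∈ π) → r ∉ π → mexFrom fuel k π ≡ r
mexFrom≡ zero k r π k≤r r<k+0 _ _ = ⊥-elim (ℕₚ.<⇒≱ (subst (r <_) (ℕₚ.+-identityʳ k) r<k+0) k≤r)
mexFrom≡ (suc fuel) k r π k≤r r<k+f below r∉π with ℕₚ.m≤n⇒m<n∨m≡n k≤r | k ∈? π
... | inj₂ refl | yes r∈π = ⊥-elim (r∉π r∈π)
... | inj₂ refl | no  _   = refl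
... | inj₁ k<r  | yes _   = mexFrom≡ fuel (suc k) r π k<r (subst (r <_) (ℕₚ.+-suc k fuel) r<k+f)
                              (λ j k<j j<r → below j (ℕₚ.<⇒≤ k<j) j<r) r∉π
... | inj₁ k<r  | no k∉π  = ⊥-elim (k∉π (below k ℕₚ.≤-refl k<r))

-- r ≤ 1 + length π is what makes the fuel of mex sufficient.
record BoundedMex (m : ℕ) (π : List ℕ) (r : ℕ) : Set where
  field
    parts≤m : All (_≤ m) π
    1≤r     : 1 ≤ r
    r≤1+len : r ≤ suc (length π)
    r≤1+m   : r ≤ suc m
    below   : ∀ j → 1 ≤ j → j < r → j ∈ π
    r∉π     : r ∉ π

open BoundedMex

Admissible : ℕ → List ℕ → Set
Admissible m π = ∃ (BoundedMex m π)

mex≡ : ∀ {m π r} → BoundedMex m π r → mex π ≡ r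
mex≡ {π = π} {r} b = mexFrom≡ (suc (length π)) 1 r π (1≤r b) (s≤s (r≤1+len b)) (below b) (r∉π b)

∉-beyond : ∀ {m π x} → All (_≤ m) π → m < x → x ∉ π
∉-beyond (y≤m ∷ _) m<x (here refl) = ℕₚ.<⇒≱ m<x y≤m
∉-beyond (_ ∷ ≤m)  m<x (there x∈π) = ∉-beyond ≤m m<x x∈π

admissible-[] : ∀ m → Admissible m []
admissible-[] m = 1 , record
  { parts≤m = [] ; 1≤r = ℕₚ.≤-refl ; r≤1+len = ℕₚ.≤-refl ; r≤1+m = s≤s z≤n
  ; below = λ j 1≤j j<1 → ⊥-elim (ℕₚ.<⇒≱ j<1 1≤j) ; r∉π = λ () }

admissible-weaken : ∀ {m π} → Admissible m π → Admissible (suc m) π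
admissible-weaken (r , b) = r , record
  { parts≤m = All.map ℕₚ.m≤n⇒m≤1+n (parts≤m b) ; 1≤r = 1≤r b ; r≤1+len = r≤1+len b
  ; r≤1+m = ℕₚ.m≤n⇒m≤1+n (r≤1+m b) ; below = below b ; r∉π = r∉π b }

data MexOfCons (m : ℕ) (π : List ℕ) : Set where
  mex-kept  : ∀ {r} → r ≤ m → BoundedMex m π r → BoundedMex (suc m) (suc m ∷ π) r → MexOfCons m π
  mex-jumps : BoundedMex m π (suc m) → BoundedMex (suc m) (suc m ∷ π) (suc (suc m)) → MexOfCons m π

boundedMex-∷-kept : ∀ {m π r} → r ≤ m → BoundedMex m π r → BoundedMex (suc m) (suc m ∷ π) r
boundedMex-∷-kept r≤m b = record
  { parts≤m = ℕₚ.≤-refl ∷ All.map ℕₚ.m≤n⇒m≤1+n (parts≤m b) ; 1≤r = 1≤r b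
  ; r≤1+len = ℕₚ.m≤n⇒m≤1+n (r≤1+len b) ; r≤1+m = ℕₚ.m≤n⇒m≤1+n (r≤1+m b)
  ; below = λ j 1≤j j<r → there (below b j 1≤j j<r)
  ; r∉π = λ { (here r≡1+m) → ℕₚ.<⇒≢ (s≤s r≤m) r≡1+m ; (there r∈π) → r∉π b r∈π } }

boundedMex-∷-jump : ∀ {m π} → BoundedMex m π (suc m) → BoundedMex (suc m) (suc m ∷ π) (suc (suc m))
boundedMex-∷-jump {m} {π} b = record
  { parts≤m = ℕₚ.≤-refl ∷ All.map ℕₚ.m≤n⇒m≤1+n (parts≤m b) ; 1≤r = s≤s z≤n
  ; r≤1+len = s≤s (r≤1+len b) ; r≤1+m = ℕₚ.≤-refl ; below = below′
  ; r∉π = λ { (here 2+m≡1+m) → ℕₚ.<⇒≢ (ℕₚ.n<1+n (suc m)) (sym 2+m≡1+m)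
            ; (there 2+m∈π) → ∉-beyond (parts≤m b) (ℕₚ.m<n⇒m<1+n (ℕₚ.n<1+n m)) 2+m∈π } }
  where
  below′ : ∀ j → 1 ≤ j → j < suc (suc m) → j ∈ suc m ∷ π
  below′ j 1≤j (s≤s j≤1+m) with ℕₚ.m≤n⇒m<n∨m≡n j≤1+m
  ... | inj₁ j<1+m = there (below b j 1≤j j<1+m)
  ... | inj₂ refl  = here refl

mexOfCons : ∀ {m π} → Admissible m π → MexOfCons m π
mexOfCons (r , b) with ℕₚ.m≤n⇒m<n∨m≡n (r≤1+m b)
... | inj₁ (s≤s r≤m) = mex-kept r≤m b (boundedMex-∷-kept r≤m b)
... | inj₂ refl      = mex-jumps b (boundedMex-∷-jump b)

admissible-∷ : ∀ {m π} → Admissible m π → Admissible (suc m) (suc m ∷ π)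
admissible-∷ a with mexOfCons a
... | mex-kept _ _ b′ = _ , b′
... | mex-jumps _ b′  = _ , b′

dpartsBounded-admissible : ∀ m K → All (Admissible m) (dpartsBounded m K)
dpartsBounded-admissible m       zero    = admissible-[] m ∷ []
dpartsBounded-admissible zero    (suc K) = []
dpartsBounded-admissible (suc m) (suc K) =
  ++⁺ (guarded (suc m ≤ᵇ suc K)) (All.map admissible-weaken (dpartsBounded-admissible m (suc K)))
  where
  guarded : ∀ b → All (Admissible (suc m)) (if b then map (suc m ∷_) (dpartsBounded m (K ∸ m)) else [])
  guarded true  = map⁺ (All.map admissible-∷ (dpartsBounded-admissible m (K ∸ m)))
  guarded false = []

oddᶻ : ℕ → ℤ
oddᶻ n = if isOdd n then 1ℤ else 0ℤ

oddᶻ-suc : ∀ n → oddᶻ (suc n) ≡ oddᶻ n + -1^ n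
oddᶻ-suc zero    = refl
oddᶻ-suc (suc n) = begin
  oddᶻ n                           ≡⟨ cancel (oddᶻ n) (-1^ n) ⟨
  oddᶻ n + -1^ n + -1ℤ * -1^ n     ≡⟨ cong (_+ -1^ (suc n)) (oddᶻ-suc n) ⟨
  oddᶻ (suc n) + -1^ (suc n)       ∎
  where
  open ≡-Reasoning
  cancel : ∀ a s → a + s + -1ℤ * s ≡ a
  cancel = solve-∀

mexOdd : List ℕ → ℤ
mexOdd π = oddᶻ (mex π)

mexIs : ℕ → List ℕ → ℤ
mexIs r π = if does (mex π ≟ r) then 1ℤ else 0ℤ

mexOdd-∷ : ∀ {m π} → Admissible m π → mexOdd (suc m ∷ π) ≡ mexOdd π + -1^ (suc m) * mexIs (suc m) π
mexOdd-∷ {m} a with mexOfCons a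
... | mex-kept {r} r≤m b b′ rewrite mex≡ b | mex≡ b′ | dec-false (r ≟ suc m) (ℕₚ.<⇒≢ (s≤s r≤m)) =
  sym (trans (cong (_+_ (oddᶻ r)) (ℤₚ.*-zeroʳ (-1^ suc m))) (ℤₚ.+-identityʳ (oddᶻ r)))
... | mex-jumps b b′ rewrite mex≡ b | mex≡ b′ | dec-true (suc m ≟ suc m) refl =
  trans (oddᶻ-suc (suc m)) (cong (_+_ (oddᶻ (suc m))) (sym (ℤₚ.*-identityʳ (-1^ suc m))))

mexIs-∷ : ∀ {m π} → Admissible m π → mexIs (suc (suc m)) (suc m ∷ π) ≡ mexIs (suc m) π
mexIs-∷ {m} a with mexOfCons a
... | mex-kept {r} r≤m b b′ rewrite mex≡ b | mex≡ b′
  | dec-false (r ≟ suc m) (ℕₚ.<⇒≢ (s≤s r≤m))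
  | dec-false (r ≟ suc (suc m)) (ℕₚ.<⇒≢ (s≤s (ℕₚ.m≤n⇒m≤1+n r≤m))) = refl
... | mex-jumps b b′ rewrite mex≡ b | mex≡ b′ | dec-true (suc m ≟ suc m) refl = refl

mexIs-beyond : ∀ {m π} → Admissible m π → mexIs (suc (suc m)) π ≡ 0ℤ
mexIs-beyond {m} (r , b) rewrite mex≡ b | dec-false (r ≟ suc (suc m)) (ℕₚ.<⇒≢ (s≤s (r≤1+m b))) = refl

weightSum : (List ℕ → ℤ) → List (List ℕ) → ℤ
weightSum w πs = sumℤ (map w πs)

weightSum-++ : ∀ w πs σs → weightSum w (πs ++ σs) ≡ weightSum w πs + weightSum w σs
weightSum-++ w []       σs = sym (ℤₚ.+-identityˡ _)
weightSum-++ w (π ∷ πs) σs = trans (cong (_+_ (w π)) (weightSum-++ w πs σs)) (sym (ℤₚ.+-assoc (w π) _ _))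

weightSum-map : ∀ w f πs → weightSum w (map f πs) ≡ weightSum (w ∘ f) πs
weightSum-map w f []       = refl
weightSum-map w f (π ∷ πs) = cong (_+_ (w (f π))) (weightSum-map w f πs)

weightSum-cong : ∀ {P : List ℕ → Set} {w v} {πs} → All P πs → (∀ {π} → P π → w π ≡ v π) →
                 weightSum w πs ≡ weightSum v πs
weightSum-cong []         w≡v = refl
weightSum-cong (p ∷ ps)   w≡v = cong₂ _+_ (w≡v p) (weightSum-cong ps w≡v)

weightSum-+ : ∀ w v πs → weightSum (λ π → w π + v π) πs ≡ weightSum w πs + weightSum v πs
weightSum-+ w v []       = refl
weightSum-+ w v (π ∷ πs) = trans (cong (_+_ (w π + v π)) (weightSum-+ w v πs)) (interchange (w π) (v π) _ _)
  where
  interchange : ∀ a b c d → (a + b) + (c + d) ≡ (a + c) + (b + d)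
  interchange = solve-∀

weightSum-*ˡ : ∀ c w πs → weightSum (λ π → c * w π) πs ≡ c * weightSum w πs
weightSum-*ˡ c w []       = sym (ℤₚ.*-zeroʳ c)
weightSum-*ˡ c w (π ∷ πs) =
  trans (cong (_+_ (c * w π)) (weightSum-*ˡ c w πs)) (sym (ℤₚ.*-distribˡ-+ c (w π) _))

weightSum-0 : ∀ πs → weightSum (const 0ℤ) πs ≡ 0ℤ
weightSum-0 []       = refl
weightSum-0 (π ∷ πs) = trans (ℤₚ.+-identityˡ _) (weightSum-0 πs)

count≡weightSum : ∀ πs → + length (filter (λ π → T? (isOdd (mex π))) πs) ≡ weightSum mexOdd πs
count≡weightSum []       = refl
count≡weightSum (π ∷ πs) with isOdd (mex π)
... | true  = cong (_+_ 1ℤ) (count≡weightSum πs)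
... | false = trans (count≡weightSum πs) (sym (ℤₚ.+-identityˡ _))

distinctPartsGF : (List ℕ → ℤ) → ℕ → PS
distinctPartsGF w m K = weightSum w (dpartsBounded m K)

distinctPartsGF-suc : ∀ w m →
  distinctPartsGF w (suc m) ≗ distinctPartsGF w m ⊕ shift (suc m) (distinctPartsGF (w ∘ (suc m ∷_)) m)
distinctPartsGF-suc w m zero    = sym (ℤₚ.+-identityʳ _)
distinctPartsGF-suc w m (suc K) = begin
  weightSum w (withLargest (suc m ≤ᵇ suc K) ++ rest)
    ≡⟨ weightSum-++ w (withLargest (suc m ≤ᵇ suc K)) rest ⟩
  weightSum w (withLargest (suc m ≤ᵇ suc K)) + weightSum w rest
    ≡⟨ cong (_+ weightSum w rest) (weightSum-withLargest (suc m ≤ᵇ suc K)) ⟩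
  shift (suc m) (distinctPartsGF (w ∘ (suc m ∷_)) m) (suc K) + weightSum w rest
    ≡⟨ ℤₚ.+-comm _ (weightSum w rest) ⟩
  weightSum w rest + shift (suc m) (distinctPartsGF (w ∘ (suc m ∷_)) m) (suc K) ∎
  where
  open ≡-Reasoning
  rest = dpartsBounded m (suc K)
  withLargest : Bool → List (List ℕ)
  withLargest b = if b then map (suc m ∷_) (dpartsBounded m (K ∸ m)) else []
  weightSum-withLargest : ∀ b →
    weightSum w (withLargest b) ≡ (if b then weightSum (w ∘ (suc m ∷_)) (dpartsBounded m (K ∸ m)) else 0ℤ)
  weightSum-withLargest true  = weightSum-map w (suc m ∷_) (dpartsBounded m (K ∸ m))
  weightSum-withLargest false = refl

distinctPartsGF-cong : ∀ {w v} m → (∀ {π} → Admissible m π → w π ≡ v π) →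
                       distinctPartsGF w m ≗ distinctPartsGF v m
distinctPartsGF-cong m w≡v K = weightSum-cong (dpartsBounded-admissible m K) w≡v

distinctPartsGF-+ : ∀ w v m →
                    distinctPartsGF (λ π → w π + v π) m ≗ distinctPartsGF w m ⊕ distinctPartsGF v m
distinctPartsGF-+ w v m K = weightSum-+ w v (dpartsBounded m K)

distinctPartsGF-· : ∀ c w m → distinctPartsGF (λ π → c * w π) m ≗ c · distinctPartsGF w m
distinctPartsGF-· c w m K = weightSum-*ˡ c w (dpartsBounded m K)

distinctPartsGF-0 : ∀ m → distinctPartsGF (const 0ℤ) m ≗ const 0ℤ
distinctPartsGF-0 m K = weightSum-0 (dpartsBounded m K)

-- The only partition with parts ≤ m and mex m+1 is {1,…,m}.
distinctPartsGF-mexIs : ∀ m → distinctPartsGF (mexIs (suc m)) m ≗ qpow (tri m)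
distinctPartsGF-mexIs zero    zero    = refl
distinctPartsGF-mexIs zero    (suc K) = refl
distinctPartsGF-mexIs (suc m) = begin
  distinctPartsGF (mexIs (suc (suc m))) (suc m)
    ≈⟨ distinctPartsGF-suc (mexIs (suc (suc m))) m ⟩
  distinctPartsGF (mexIs (suc (suc m))) m ⊕ shift (suc m) (distinctPartsGF (mexIs (suc (suc m)) ∘ (suc m ∷_)) m)
    ≈⟨ ⊕-cong (λ K → trans (distinctPartsGF-cong m mexIs-beyond K) (distinctPartsGF-0 m K))
              (shift-cong (suc m) (λ K → trans (distinctPartsGF-cong m mexIs-∷ K) (distinctPartsGF-mexIs m K))) ⟩
  const 0ℤ ⊕ shift (suc m) (qpow (tri m))
    ≈⟨ (λ K → ℤₚ.+-identityˡ _) ⟩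
  shift (suc m) (qpow (tri m))
    ≈⟨ qpow-+ (suc m) (tri m) ⟨
  qpow (tri (suc m)) ∎
  where open ≗-Reasoning

distinctPartsGF-mexOdd : ∀ m → distinctPartsGF mexOdd m ≗ partialU m
distinctPartsGF-mexOdd zero = λ K → trans (base K) (sym (partialU-zero K))
  where
  base : distinctPartsGF mexOdd 0 ≗ one
  base zero    = refl
  base (suc K) = refl
distinctPartsGF-mexOdd (suc m) = begin
  G mexOdd (suc m)
    ≈⟨ distinctPartsGF-suc mexOdd m ⟩
  G mexOdd m ⊕ shift (suc m) (G (mexOdd ∘ (suc m ∷_)) m)
    ≈⟨ ⊕-congˡ (G mexOdd m) (shift-cong (suc m) split) ⟩
  G mexOdd m ⊕ shift (suc m) (G mexOdd m ⊕ s · G (mexIs (suc m)) m)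
    ≈⟨ ⊕-cong IH (shift-cong (suc m) (⊕-cong IH (·-congˡ s (distinctPartsGF-mexIs m)))) ⟩
  partialU m ⊕ shift (suc m) (partialU m ⊕ s · qpow (tri m))
    ≈⟨ partialU-suc m ⟨
  partialU (suc m) ∎
  where
  open ≗-Reasoning
  G = distinctPartsGF
  s = -1^ (suc m)
  IH = distinctPartsGF-mexOdd m
  split : G (mexOdd ∘ (suc m ∷_)) m ≗ G mexOdd m ⊕ s · G (mexIs (suc m)) m
  split = begin
    G (mexOdd ∘ (suc m ∷_)) m                     ≈⟨ distinctPartsGF-cong m mexOdd-∷ ⟩
    G (λ π → mexOdd π + s * mexIs (suc m) π) m    ≈⟨ distinctPartsGF-+ mexOdd (λ π → s * mexIs (suc m) π) m ⟩
    G mexOdd m ⊕ G (λ π → s * mexIs (suc m) π) m  ≈⟨ ⊕-congˡ (G mexOdd m) (distinctPartsGF-· s (mexIs (suc m)) m) ⟩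
    G mexOdd m ⊕ s · G (mexIs (suc m)) m          ∎

theorem2p4 : (n : ℕ) → U n ≡ + a-d n
theorem2p4 n = begin
  U n                         ≡⟨ U≡partialU n ⟩
  partialU n n                ≡⟨ distinctPartsGF-mexOdd n n ⟨
  distinctPartsGF mexOdd n n  ≡⟨ count≡weightSum (dparts n) ⟨
  + a-d n                     ∎
  where open ≡-Reasoning
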